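{- For positive integers $x,y,m,r$, if $x\mid y$, then $L_m^{(r)}(x)\mid L_m^{(r)}(y)$.
   Context: For $m,n\in\mathbb{N}$, the Schemmel totient function $L_m(n)$ is the number of integers $k\in\{1,\dots,n\}$ such that $\gcd(k+s,n)=1$ for all $s\in\{0,1,\dots,m-1\}$; by convention $L_m(0)=0$. Equivalently, $L_m(1)=1$, and for $n>1$ with $n=\prod_{i=1}^r p_i^{\alpha_i}$, $L_m(n)=0$ if the smallest prime factor of $n$ is $\le m$, and $L_m(n)=\prod_{i} p_i^{\alpha_i-1}(p_i-m)$ otherwise. Iterates: $f^{(1)}=f$, $f^{(k+1)}=f\circ f^{(k)}$. Divisibility includes $a\mid 0$ for every integer $a$. -}

module Defs where

open import Data.Nat using (ℕ; zero; suc; _+_)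
open import Data.Nat.GCD using (gcd)
open import Data.Nat.Properties using (_≟_)
open import Data.Bool using (Bool; true; false; _∧_; if_then_else_)
open import Relation.Nullary.Decidable using (⌊_⌋)

allCoprime : ℕ → ℕ → ℕ → Bool
allCoprime zero    k n = true
allCoprime (suc s) k n = ⌊ gcd (k + s) n ≟ 1 ⌋ ∧ allCoprime s k n

countUpTo : ℕ → ℕ → ℕ → ℕ
countUpTo m zero    n = 0
countUpTo m (suc j) n =
  (if allCoprime m (suc j) n then 1 else 0) + countUpTo m j n

-- Schemmel totient L_m(n); for n = 0 the range {1..0} is empty so L_m(0) = 0
L : ℕ → ℕ → ℕ
L m n = countUpTo m n n

iterate : (ℕ → ℕ) → ℕ → ℕ → ℕ
iterate f zero    x = x
iterate f (suc r) x = f (iterate f r x)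

{-# OPTIONS --safe #-}
module Submission where

-- Sort the k ∈ {1, …, x p} by their residue mod x: k = 1 + i + x j with i < x and j < p.
-- Being admissible (all of k, …, k + m - 1 coprime to the modulus) for x p means being
-- admissible for x, which depends on i only, and for p, so L_m(x p) = Σ_i c(i) over the
-- i admissible for x, where c(i) counts the lifts j < p admissible for p.  If p ∣ x every
-- lift of an i admissible for x is admissible for p, so c(i) = p; if x and p are coprime,
-- c has periods x and p, hence period 1.  In both cases L_m(x p) = L_m(x) · c, and a general
-- multiple x q reduces to these cases by splitting off d = gcd(x, q) and recursing on q / d.

open import Defs
open import Data.Nat using (ℕ; NonZero; zero; suc; _+_; _*_; _<_; n>1⇒nonTrivial)
open import Data.Nat.Properties
open import Data.Nat.Divisibility
open import Data.Nat.GCD using (gcd; gcd[m,n]∣m; gcd[m,n]∣n; gcd-greatest; gcd[m,n]≢0; module Bézout)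
open import Data.Nat.Coprimality
  using (Coprime; coprime?; gcd≡1⇒coprime; coprime⇒gcd≡1; coprime-divisor; coprime-Bézout)
open import Data.Nat.Induction using (<-rec)
open import Data.Bool using (Bool; true; false; T; _∧_; if_then_else_)
open import Data.Bool.Properties using (∧-commutativeMonoid; T-∧; T-≡)
open import Data.Product using (_×_; _,_; proj₂)
open import Data.Sum using (inj₂)
open import Function.Bundles using (_⇔_; mk⇔; Equivalence)
open import Relation.Nullary using (¬_; yes; no)
open import Relation.Nullary.Decidable using (⌊_⌋; does; isYes≗does; does-⇔; _×-dec_)
open import Relation.Binary.PropositionalEquality
open import Algebra.Bundles using (CommutativeMonoid)
open import Algebra.Properties.CommutativeSemigroup +-commutativeSemigroup
  using () renaming (interchange to +-interchange; xy∙z≈xz∙y to +-right-comm)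
open import Algebra.Properties.CommutativeSemigroup *-commutativeSemigroup
  using () renaming (xy∙z≈xz∙y to *-right-comm)
open import Algebra.Properties.CommutativeSemigroup
  (CommutativeMonoid.commutativeSemigroup ∧-commutativeMonoid)
  using () renaming (interchange to ∧-interchange)

open ≡-Reasoning

𝟙 : Bool → ℕ
𝟙 b = if b then 1 else 0

𝟙-∧ : ∀ a b → 𝟙 (a ∧ b) ≡ 𝟙 a * 𝟙 b
𝟙-∧ true  b = sym (+-identityʳ (𝟙 b))
𝟙-∧ false b = refl

∑ : ℕ → (ℕ → ℕ) → ℕ
∑ zero    f = 0
∑ (suc n) f = ∑ n f + f n

infix 5 ∑
syntax ∑ n (λ i → e) = ∑[ i < n ] e

∑-cong : ∀ {f g : ℕ → ℕ} n → (∀ i → f i ≡ g i) → ∑ n f ≡ ∑ n g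
∑-cong zero    f≗g = refl
∑-cong (suc n) f≗g = cong₂ _+_ (∑-cong n f≗g) (f≗g n)

∑-const : ∀ n c → ∑[ _ < n ] c ≡ n * c
∑-const zero    c = refl
∑-const (suc n) c = trans (cong (_+ c) (∑-const n c)) (+-comm (n * c) c)

∑-*ˡ : ∀ (f : ℕ → ℕ) c n → ∑[ i < n ] c * f i ≡ c * ∑ n f
∑-*ˡ f c zero    = sym (*-zeroʳ c)
∑-*ˡ f c (suc n) = trans (cong (_+ c * f n) (∑-*ˡ f c n)) (sym (*-distribˡ-+ c (∑ n f) (f n)))

∑-*ʳ : ∀ (f : ℕ → ℕ) c n → ∑[ i < n ] f i * c ≡ ∑ n f * c
∑-*ʳ f c zero    = refl
∑-*ʳ f c (suc n) = trans (cong (_+ f n * c) (∑-*ʳ f c n)) (sym (*-distribʳ-+ c (∑ n f) (f n)))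

∑-distrib-+ : ∀ (f g : ℕ → ℕ) n → ∑[ i < n ] (f i + g i) ≡ ∑ n f + ∑ n g
∑-distrib-+ f g zero    = refl
∑-distrib-+ f g (suc n) =
  trans (cong (_+ (f n + g n)) (∑-distrib-+ f g n)) (+-interchange (∑ n f) (∑ n g) (f n) (g n))

∑-comm : ∀ (g : ℕ → ℕ → ℕ) a b → ∑[ j < b ] ∑[ i < a ] g j i ≡ ∑[ i < a ] ∑[ j < b ] g j i
∑-comm g a zero    = sym (trans (∑-const a 0) (*-zeroʳ a))
∑-comm g a (suc b) = trans (cong (_+ (∑[ i < a ] g b i)) (∑-comm g a b))
                           (sym (∑-distrib-+ (λ i → ∑[ j < b ] g j i) (g b) a))

∑-split : ∀ (f : ℕ → ℕ) a b → ∑ (a + b) f ≡ ∑ a f + (∑[ k < b ] f (a + k))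
∑-split f a zero    = trans (cong (λ n → ∑ n f) (+-identityʳ a)) (sym (+-identityʳ (∑ a f)))
∑-split f a (suc b) = begin
  ∑ (a + suc b) f                                  ≡⟨ cong (λ n → ∑ n f) (+-suc a b) ⟩
  ∑ (a + b) f + f (a + b)                          ≡⟨ cong (_+ f (a + b)) (∑-split f a b) ⟩
  ∑ a f + (∑[ k < b ] f (a + k)) + f (a + b)       ≡⟨ +-assoc (∑ a f) _ (f (a + b)) ⟩
  ∑ a f + (∑[ k < suc b ] f (a + k))               ∎

∑-blocks : ∀ (f : ℕ → ℕ) x q → ∑ (q * x) f ≡ ∑[ j < q ] ∑[ i < x ] f (i + x * j)
∑-blocks f x zero    = refl
∑-blocks f x (suc q) = begin
  ∑ (x + q * x) f                                   ≡⟨ cong (λ n → ∑ n f) (+-comm x (q * x)) ⟩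
  ∑ (q * x + x) f                                   ≡⟨ ∑-split f (q * x) x ⟩
  ∑ (q * x) f + (∑[ i < x ] f (q * x + i))          ≡⟨ cong₂ _+_ (∑-blocks f x q) (∑-cong x λ i →
                                                         cong f (trans (+-comm (q * x) i) (cong (i +_) (*-comm q x)))) ⟩
  ∑[ j < suc q ] ∑[ i < x ] f (i + x * j)           ∎

∑-rotate : ∀ (f : ℕ → ℕ) n → f n ≡ f 0 → ∑[ k < n ] f (suc k) ≡ ∑ n f
∑-rotate f n fn≡f0 = +-cancelʳ-≡ (f 0) _ _ (begin
  (∑[ k < n ] f (suc k)) + f 0                      ≡⟨ +-comm _ (f 0) ⟩
  f 0 + (∑[ k < n ] f (suc k))                      ≡⟨ ∑-split f 1 n ⟨
  ∑ n f + f n                                       ≡⟨ cong (∑ n f +_) fn≡f0 ⟩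
  ∑ n f + f 0                                       ∎)

Periodic : {A : Set} → ℕ → (ℕ → A) → Set
Periodic n f = ∀ i → f (i + n) ≡ f i

periodic-* : ∀ {A : Set} {n} {f : ℕ → A} → Periodic n f → ∀ i k → f (i + k * n) ≡ f i
periodic-* {n = n} {f} per i zero    = cong f (+-identityʳ i)
periodic-* {n = n} {f} per i (suc k) = begin
  f (i + (n + k * n))   ≡⟨ cong f (trans (cong (i +_) (+-comm n (k * n))) (sym (+-assoc i (k * n) n))) ⟩
  f (i + k * n + n)     ≡⟨ per (i + k * n) ⟩
  f (i + k * n)         ≡⟨ periodic-* per i k ⟩
  f i                   ∎

periodic-coprime⇒constant : ∀ {A : Set} {a b} {f : ℕ → A} → Coprime a b →
                            Periodic a f → Periodic b f → ∀ i → f i ≡ f 0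
periodic-coprime⇒constant {a = a} {b} {f} a⊥b per-a per-b = constant
  where
  step : ∀ i → f (suc i) ≡ f i
  step i with coprime-Bézout a⊥b
  ... | Bézout.+- u v 1+vb≡ua = begin
    f (suc i)          ≡⟨ periodic-* per-b (suc i) v ⟨
    f (suc i + v * b)  ≡⟨ cong f (trans (sym (+-suc i (v * b))) (cong (i +_) 1+vb≡ua)) ⟩
    f (i + u * a)      ≡⟨ periodic-* per-a i u ⟩
    f i                ∎
  ... | Bézout.-+ u v 1+ua≡vb = begin
    f (suc i)          ≡⟨ periodic-* per-a (suc i) u ⟨
    f (suc i + u * a)  ≡⟨ cong f (trans (sym (+-suc i (u * a))) (cong (i +_) 1+ua≡vb)) ⟩
    f (i + v * b)      ≡⟨ periodic-* per-b i v ⟩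
    f i                ∎
  constant : ∀ i → f i ≡ f 0
  constant zero    = refl
  constant (suc i) = trans (step i) (constant i)

gcd[m+n,n]≡gcd[m,n] : ∀ m n → gcd (m + n) n ≡ gcd m n
gcd[m+n,n]≡gcd[m,n] m n = ∣-antisym
  (gcd-greatest (∣m+n∣m⇒∣n (subst (gcd (m + n) n ∣_) (+-comm m n) (gcd[m,n]∣m (m + n) n)) (gcd[m,n]∣n (m + n) n))
                (gcd[m,n]∣n (m + n) n))
  (gcd-greatest (∣m∣n⇒∣m+n (gcd[m,n]∣m m n) (gcd[m,n]∣n m n)) (gcd[m,n]∣n m n))

coprime-*ʳ⇔ : ∀ t a b → Coprime t (a * b) ⇔ (Coprime t a × Coprime t b)
coprime-*ʳ⇔ t a b = mk⇔
  (λ t⊥ab → (λ {_} (d∣t , d∣a) → t⊥ab (d∣t , ∣m⇒∣m*n b d∣a))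
          , (λ {_} (d∣t , d∣b) → t⊥ab (d∣t , ∣n⇒∣m*n a d∣b)))
  (λ (t⊥a , t⊥b) {d} (d∣t , d∣ab) →
     let d⊥a : Coprime d a
         d⊥a (e∣d , e∣a) = t⊥a (∣-trans e∣d d∣t , e∣a)
     in t⊥b (d∣t , coprime-divisor d⊥a d∣ab))

gcd≡1-*ʳ : ∀ t a b → ⌊ gcd t (a * b) ≟ 1 ⌋ ≡ ⌊ gcd t a ≟ 1 ⌋ ∧ ⌊ gcd t b ≟ 1 ⌋
gcd≡1-*ʳ t a b = begin
  ⌊ gcd t (a * b) ≟ 1 ⌋                         ≡⟨ isYes≗does (gcd t (a * b) ≟ 1) ⟩
  does (gcd t (a * b) ≟ 1)                      ≡⟨ does-⇔ gcd≡1⇔ (gcd t (a * b) ≟ 1) ((gcd t a ≟ 1) ×-dec (gcd t b ≟ 1)) ⟩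
  does (gcd t a ≟ 1) ∧ does (gcd t b ≟ 1)       ≡⟨ cong₂ _∧_ (isYes≗does (gcd t a ≟ 1)) (isYes≗does (gcd t b ≟ 1)) ⟨
  ⌊ gcd t a ≟ 1 ⌋ ∧ ⌊ gcd t b ≟ 1 ⌋             ∎
  where
  open Equivalence (coprime-*ʳ⇔ t a b)
  gcd≡1⇔ : gcd t (a * b) ≡ 1 ⇔ (gcd t a ≡ 1 × gcd t b ≡ 1)
  gcd≡1⇔ = mk⇔
    (λ eq → let (t⊥a , t⊥b) = to (gcd≡1⇒coprime eq) in coprime⇒gcd≡1 t⊥a , coprime⇒gcd≡1 t⊥b)
    (λ (eqa , eqb) → coprime⇒gcd≡1 (from (gcd≡1⇒coprime eqa , gcd≡1⇒coprime eqb)))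

allCoprime-* : ∀ m k a b → allCoprime m k (a * b) ≡ allCoprime m k a ∧ allCoprime m k b
allCoprime-* zero    k a b = refl
allCoprime-* (suc s) k a b rewrite allCoprime-* s k a b | gcd≡1-*ʳ (k + s) a b =
  ∧-interchange ⌊ gcd (k + s) a ≟ 1 ⌋ ⌊ gcd (k + s) b ≟ 1 ⌋ (allCoprime s k a) (allCoprime s k b)

allCoprime-∣ : ∀ m k {p n} → p ∣ n → T (allCoprime m k n) → T (allCoprime m k p)
allCoprime-∣ m k {p} (divides q refl) admissible =
  proj₂ (Equivalence.to T-∧ (subst T (allCoprime-* m k q p) admissible))

allCoprime-periodic : ∀ m n → Periodic n (λ k → allCoprime m k n)
allCoprime-periodic zero    n k = refl
allCoprime-periodic (suc s) n k = cong₂ _∧_ gcd-shift (allCoprime-periodic s n k)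
  where
  gcd-shift : ⌊ gcd (k + n + s) n ≟ 1 ⌋ ≡ ⌊ gcd (k + s) n ≟ 1 ⌋
  gcd-shift rewrite +-right-comm k n s | gcd[m+n,n]≡gcd[m,n] (k + s) n = refl

L≡∑ : ∀ m n → L m n ≡ ∑[ k < n ] 𝟙 (allCoprime m (suc k) n)
L≡∑ m n = count≡∑ n
  where
  count≡∑ : ∀ j → countUpTo m j n ≡ ∑[ k < j ] 𝟙 (allCoprime m (suc k) n)
  count≡∑ zero    = refl
  count≡∑ (suc j) = trans (+-comm (𝟙 admissible) (countUpTo m j n)) (cong (_+ 𝟙 admissible) (count≡∑ j))
    where admissible = allCoprime m (suc j) n

liftCount : ℕ → ℕ → ℕ → ℕ → ℕ
liftCount m x p i = ∑[ j < p ] 𝟙 (allCoprime m (suc (i + x * j)) p)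

L-*≡∑-liftCount : ∀ m x p →
  L m (x * p) ≡ ∑[ i < x ] 𝟙 (allCoprime m (suc i) x) * liftCount m x p i
L-*≡∑-liftCount m x p = begin
  L m (x * p)                                    ≡⟨ L≡∑ m (x * p) ⟩
  ∑ (x * p) F                                    ≡⟨ cong (λ n → ∑ n F) (*-comm x p) ⟩
  ∑ (p * x) F                                    ≡⟨ ∑-blocks F x p ⟩
  ∑[ j < p ] ∑[ i < x ] F (i + x * j)            ≡⟨ ∑-comm (λ j i → F (i + x * j)) x p ⟩
  ∑[ i < x ] ∑[ j < p ] F (i + x * j)            ≡⟨ ∑-cong x (λ i → trans (∑-cong p (F-split i)) (∑-*ˡ _ (G i) p)) ⟩
  ∑[ i < x ] G i * liftCount m x p i             ∎
  where
  F : ℕ → ℕ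
  F k = 𝟙 (allCoprime m (suc k) (x * p))
  G : ℕ → ℕ
  G i = 𝟙 (allCoprime m (suc i) x)
  F-split : ∀ i j → F (i + x * j) ≡ G i * 𝟙 (allCoprime m (suc (i + x * j)) p)
  F-split i j = begin
    F (i + x * j)                  ≡⟨ cong 𝟙 (allCoprime-* m k x p) ⟩
    𝟙 (allCoprime m k x ∧ lift)    ≡⟨ 𝟙-∧ (allCoprime m k x) lift ⟩
    𝟙 (allCoprime m k x) * 𝟙 lift  ≡⟨ cong (λ b → 𝟙 b * 𝟙 lift) residue ⟩
    G i * 𝟙 lift                   ∎
    where
    k = suc (i + x * j)
    lift = allCoprime m k p
    residue : allCoprime m k x ≡ allCoprime m (suc i) x
    residue = trans (cong (λ l → allCoprime m (suc i + l) x) (*-comm x j))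
                    (periodic-* (allCoprime-periodic m x) (suc i) j)

liftCount-periodicᵖ : ∀ m x p → Periodic p (liftCount m x p)
liftCount-periodicᵖ m x p i = ∑-cong p λ j → cong 𝟙 (begin
  allCoprime m (suc (i + p + x * j)) p     ≡⟨ cong (λ k → allCoprime m (suc k) p) (+-right-comm i p (x * j)) ⟩
  allCoprime m (suc (i + x * j) + p) p     ≡⟨ allCoprime-periodic m p (suc (i + x * j)) ⟩
  allCoprime m (suc (i + x * j)) p         ∎)

liftCount-periodicˣ : ∀ m x p → Periodic x (liftCount m x p)
liftCount-periodicˣ m x p i = begin
  ∑[ j < p ] h (i + x + x * j)   ≡⟨ ∑-cong p (λ j → cong h (trans (+-assoc i x (x * j)) (cong (i +_) (sym (*-suc x j))))) ⟩
  ∑[ j < p ] h (i + x * suc j)   ≡⟨ ∑-rotate (λ j → h (i + x * j)) p wrap ⟩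
  ∑[ j < p ] h (i + x * j)       ∎
  where
  h : ℕ → ℕ
  h k = 𝟙 (allCoprime m (suc k) p)
  wrap : h (i + x * p) ≡ h (i + x * 0)
  wrap = begin
    h (i + x * p)   ≡⟨ cong 𝟙 (periodic-* (allCoprime-periodic m p) (suc i) x) ⟩
    h i             ≡⟨ cong h (+-identityʳ i) ⟨
    h (i + 0)       ≡⟨ cong (λ k → h (i + k)) (*-zeroʳ x) ⟨
    h (i + x * 0)   ∎

L-*≡L*-constant : ∀ m x p c → (∀ i → T (allCoprime m (suc i) x) → liftCount m x p i ≡ c) →
                  L m (x * p) ≡ L m x * c
L-*≡L*-constant m x p c constant = begin
  L m (x * p)                                        ≡⟨ L-*≡∑-liftCount m x p ⟩
  ∑[ i < x ] 𝟙 (allCoprime m (suc i) x) * liftCount m x p i  ≡⟨ ∑-cong x term ⟩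
  ∑[ i < x ] 𝟙 (allCoprime m (suc i) x) * c          ≡⟨ ∑-*ʳ _ c x ⟩
  (∑[ i < x ] 𝟙 (allCoprime m (suc i) x)) * c        ≡⟨ cong (_* c) (L≡∑ m x) ⟨
  L m x * c                                          ∎
  where
  term : ∀ i → 𝟙 (allCoprime m (suc i) x) * liftCount m x p i ≡ 𝟙 (allCoprime m (suc i) x) * c
  term i with allCoprime m (suc i) x in admissible
  ... | false = refl
  ... | true  = cong (_+ 0) (constant i (subst T (sym admissible) _))

L-*-of-∣ : ∀ m x p → p ∣ x → L m (x * p) ≡ L m x * p
L-*-of-∣ m x p (divides q x≡qp) = L-*≡L*-constant m x p p everyLiftAdmissible
  where
  everyLiftAdmissible : ∀ i → T (allCoprime m (suc i) x) → liftCount m x p i ≡ p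
  everyLiftAdmissible i admissible = begin
    liftCount m x p i                       ≡⟨ ∑-cong p (λ j → cong 𝟙 (lift≡residue j)) ⟩
    ∑[ _ < p ] 𝟙 (allCoprime m (suc i) p)    ≡⟨ cong (λ b → ∑[ _ < p ] 𝟙 b) (Equivalence.to T-≡ admissibleᵖ) ⟩
    ∑[ _ < p ] 1                            ≡⟨ ∑-const p 1 ⟩
    p * 1                                   ≡⟨ *-identityʳ p ⟩
    p                                       ∎
    where
    admissibleᵖ : T (allCoprime m (suc i) p)
    admissibleᵖ = allCoprime-∣ m (suc i) (divides q x≡qp) admissible
    lift≡residue : ∀ j → allCoprime m (suc (i + x * j)) p ≡ allCoprime m (suc i) p
    lift≡residue j = begin
      allCoprime m (suc i + x * j) p         ≡⟨ cong (λ l → allCoprime m (suc i + l * j) p) x≡qp ⟩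
      allCoprime m (suc i + q * p * j) p     ≡⟨ cong (λ l → allCoprime m (suc i + l) p) (*-right-comm q p j) ⟩
      allCoprime m (suc i + q * j * p) p     ≡⟨ periodic-* (allCoprime-periodic m p) (suc i) (q * j) ⟩
      allCoprime m (suc i) p                 ∎

L-*-of-coprime : ∀ m x p → Coprime x p → L m (x * p) ≡ L m x * liftCount m x p 0
L-*-of-coprime m x p x⊥p = L-*≡L*-constant m x p (liftCount m x p 0) λ i _ →
  periodic-coprime⇒constant x⊥p (liftCount-periodicˣ m x p) (liftCount-periodicᵖ m x p) i

gcd>1 : ∀ m n .{{_ : NonZero n}} → ¬ Coprime m n → 1 < gcd m n
gcd>1 m n@(suc _) ¬m⊥n = ≤∧≢⇒< (n≢0⇒n>0 (gcd[m,n]≢0 m n (inj₂ λ ())))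
                                 (λ 1≡gcd → ¬m⊥n (gcd≡1⇒coprime (sym 1≡gcd)))

L-∣-L-* : ∀ m q x → L m x ∣ L m (x * q)
L-∣-L-* m = <-rec _ go
  where
  go : ∀ q → (∀ {q′} → q′ < q → ∀ x → L m x ∣ L m (x * q′)) → ∀ x → L m x ∣ L m (x * q)
  go zero      _   x = subst (λ n → L m x ∣ L m n) (sym (*-zeroʳ x)) (L m x ∣0)
  go q@(suc _) rec x with coprime? x q
  ... | yes x⊥q = divides (liftCount m x q 0) (trans (L-*-of-coprime m x q x⊥q) (*-comm (L m x) _))
  ... | no ¬x⊥q = ∣-trans (divides d (trans (L-*-of-∣ m x d (gcd[m,n]∣m x q)) (*-comm (L m x) d)))
                          (subst (λ n → L m (x * d) ∣ L m n) xdq′≡xq (rec (quotient-< d∣q) (x * d)))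
    where
    d = gcd x q
    d∣q = gcd[m,n]∣n x q
    instance _ = n>1⇒nonTrivial (gcd>1 x q ¬x⊥q)
    xdq′≡xq : x * d * quotient d∣q ≡ x * q
    xdq′≡xq = trans (*-assoc x d _) (cong (x *_) (sym (m∣n⇒n≡m*quotient d∣q)))

L-resp-∣ : ∀ m {x y} → x ∣ y → L m x ∣ L m y
L-resp-∣ m {x} (divides q refl) = subst (λ n → L m x ∣ L m n) (*-comm x q) (L-∣-L-* m q x)

iterate-preserves : ∀ {R : ℕ → ℕ → Set} {f : ℕ → ℕ} → (∀ {a b} → R a b → R (f a) (f b)) →
                    ∀ r {x y} → R x y → R (iterate f r x) (iterate f r y)
iterate-preserves f-pres zero    Rxy = Rxy
iterate-preserves {R} {f} f-pres (suc r) {x} {y} Rxy =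
  f-pres {iterate f r x} {iterate f r y} (iterate-preserves {R} {f} f-pres r Rxy)

proposition1p2 : (x y m r : ℕ) → NonZero x → NonZero y → NonZero m → NonZero r →
    x ∣ y → iterate (L m) r x ∣ iterate (L m) r y
proposition1p2 x y m r _ _ _ _ = iterate-preserves {R = _∣_} (L-resp-∣ m) r {x} {y}
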